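{- Let $G=(V,E)$ be a claw-free graph, let $I$ be a maximum independent set of $G$, and for $a\in I$ let $V_a=\{v\in V\setminus I: N(v)\cap I=\{a\}\}$ (the 1-packs). For $a\in I$ let $T2^a$ be the set of vertices $v\in V_a$ that have neighbours in at least two distinct 1-packs other than $V_a$, and let $T2=\bigcup_{a\in I}T2^a$. Let $G_{T2}$ be the graph with vertex set $T2$ whose edges are those edges of $G[T2]$ whose endpoints lie in different 1-packs. Let $v,w\in T2$ with $v\in V_a$, $w\in V_b$, $a\neq b$. Then $vw\in E$ if and only if $v$ and $w$ lie in the same connected component of $G_{T2}$.
   Context: A graph is claw-free if it has no induced subgraph isomorphic to $K_{1,3}$. -}

module Defs where

open import Data.Nat using (ℕ; _≤_)
open import Data.Bool using (Bool; true; false)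
open import Data.Fin using (Fin)
open import Data.Fin.Subset using (Subset; _∈_; _∉_; ∣_∣)
open import Data.Product using (Σ; _×_; ∃; ∃-syntax)
open import Relation.Nullary using (¬_)
open import Relation.Binary.PropositionalEquality using (_≡_; _≢_)
open import Relation.Binary.Construct.Closure.ReflexiveTransitive using (Star)
open import Function.Bundles using (_⇔_)

record Graph (n : ℕ) : Set where
  field
    adj       : Fin n → Fin n → Bool
    adj-sym   : ∀ u v → adj u v ≡ adj v u
    adj-irrefl : ∀ v → adj v v ≡ false

open Graph public

E : ∀ {n} → Graph n → Fin n → Fin n → Set
E G u v = adj G u v ≡ true

ClawFree : ∀ {n} → Graph n → Set
ClawFree {n} G =
  ¬ (Σ (Fin n) λ c → Σ (Fin n) λ x → Σ (Fin n) λ y → Σ (Fin n) λ z →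
       (x ≢ y) × (x ≢ z) × (y ≢ z) ×
       E G c x × E G c y × E G c z ×
       ¬ E G x y × ¬ E G x z × ¬ E G y z)

Independent : ∀ {n} → Graph n → Subset n → Set
Independent G S = ∀ u v → u ∈ S → v ∈ S → ¬ E G u v

MaximumIndependent : ∀ {n} → Graph n → Subset n → Set
MaximumIndependent G I =
  Independent G I × (∀ J → Independent G J → ∣ J ∣ ≤ ∣ I ∣)

InPack : ∀ {n} → Graph n → Subset n → Fin n → Fin n → Set
InPack G I a v = a ∈ I × v ∉ I × (∀ u → u ∈ I → (E G v u ⇔ u ≡ a))

HasNbrInPack : ∀ {n} → Graph n → Subset n → Fin n → Fin n → Set
HasNbrInPack G I v b = ∃[ x ] (InPack G I b x × E G v x)

InT2a : ∀ {n} → Graph n → Subset n → Fin n → Fin n → Set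
InT2a G I a v =
  InPack G I a v ×
  (∃[ b ] ∃[ c ] (b ≢ c × b ≢ a × c ≢ a ×
                  HasNbrInPack G I v b × HasNbrInPack G I v c))

InT2 : ∀ {n} → Graph n → Subset n → Fin n → Set
InT2 G I v = ∃[ a ] InT2a G I a v

EdgeT2 : ∀ {n} → Graph n → Subset n → Fin n → Fin n → Set
EdgeT2 G I v w =
  InT2 G I v × InT2 G I w × E G v w ×
  (∃[ a ] ∃[ b ] (a ≢ b × InPack G I a v × InPack G I b w))

SameComponentT2 : ∀ {n} → Graph n → Subset n → Fin n → Fin n → Set
SameComponentT2 G I v w = InT2 G I v × InT2 G I w × Star (EdgeT2 G I) v w

module Submission where

-- Fix v ∈ V_a.  All adjacencies come from one consequence of
-- claw-freeness: if u lies in a 1-pack V_c, then its neighbours lying in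
-- 1-packs other than V_c are pairwise adjacent (a non-adjacent pair x, y
-- would form a claw with centre u and leaves c, x, y, because the owner c
-- sees no vertex of another pack).  We then follow a walk v = u₀ … u_k in
-- G_T2 and maintain the invariant 'Near': u_i = v, or u_i ~ v with u_i in
-- another pack, or u_i ∈ V_a together with a common neighbour p of v and
-- u_i in some other pack.  Each edge of G_T2 preserves 'Near';
-- the only delicate case leaves V_a into the pack of that witness p, and
-- there the T2-condition on the new vertex supplies a third pack through
-- which the clique lemma is chained.  At the end w ∈ V_b with b ≠ a, so the
-- invariant says exactly v ~ w.  Conversely an edge vw is itself a walk of
-- length one in G_T2.

open import Defs
open import Data.Nat using (ℕ)
open import Data.Fin using (Fin; _≟_)
open import Data.Fin.Subset using (Subset; _∈_)
open import Data.Bool using (true) renaming (_≟_ to _≟ᵇ_)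
open import Data.Product using (∃-syntax; _×_; _,_; proj₁)
open import Data.Empty using (⊥-elim)
open import Relation.Nullary using (¬_; yes; no; contradiction)
open import Relation.Binary.PropositionalEquality
  using (_≡_; _≢_; refl; trans; ≢-sym)
open import Relation.Binary.Construct.Closure.ReflexiveTransitive using (Star; ε; _◅_)
open import Function.Bundles using (_⇔_; Equivalence; mk⇔)

E-sym : ∀ {n} (G : Graph n) {x y : Fin n} → E G x y → E G y x
E-sym G {x} {y} xy = trans (adj-sym G y x) xy

module Packs {n : ℕ} (G : Graph n) (I : Subset n) where

  owner-adjacent : ∀ {c u} → InPack G I c u → E G u c
  owner-adjacent (c∈I , _ , N[u]∩I) = Equivalence.from (N[u]∩I _ c∈I) refl

  other-owner-nonadjacent : ∀ {c u d} → InPack G I c u → d ∈ I → d ≢ c → ¬ E G u d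
  other-owner-nonadjacent (_ , _ , N[u]∩I) d∈I d≢c ud = d≢c (Equivalence.to (N[u]∩I _ d∈I) ud)

  owner-unique : ∀ {c d u} → InPack G I c u → InPack G I d u → c ≡ d
  owner-unique pc (_ , _ , N[u]∩I) = Equivalence.to (N[u]∩I _ (proj₁ pc)) (owner-adjacent pc)

  distinct-packs : ∀ {c d u x} → InPack G I c u → InPack G I d x → c ≢ d → u ≢ x
  distinct-packs pc pd c≢d refl = c≢d (owner-unique pc pd)

  not-in-I : ∀ {c u d} → InPack G I c u → d ∈ I → u ≢ d
  not-in-I (_ , u∉I , _) d∈I refl = u∉I d∈I

  -- A vertex of V_d lying in T2 has a neighbour in a pack other than V_d and
  -- any prescribed V_a (T2 gives two such packs; at most one of them is V_a).
  T2-escape : ∀ {d u} (a : Fin n) → InT2 G I u → InPack G I d u →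
              ∃[ g ] ∃[ t ] (g ≢ a × g ≢ d × InPack G I g t × E G u t)
  T2-escape {d} a (d′ , pd′u , g , h , g≢h , g≢d′ , h≢d′ , (t , pgt , ut) , (t′ , pht′ , ut′)) pdu
    with owner-unique pd′u pdu | g ≟ a
  ... | refl | no g≢a  = g , t , g≢a , g≢d′ , pgt , ut
  ... | refl | yes refl = h , t′ , ≢-sym g≢h , h≢d′ , pht′ , ut′

module ClawFreePacks {n : ℕ} (G : Graph n) (claw-free : ClawFree G) (I : Subset n) where
  open Packs G I

  claw-closure : ∀ {c x y z} → E G c x → E G c y → E G c z →
                 x ≢ y → x ≢ z → y ≢ z → ¬ E G x y → ¬ E G x z → E G y z
  claw-closure {c} {x} {y} {z} cx cy cz x≢y x≢z y≢z ¬xy ¬xz with adj G y z ≟ᵇ true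
  ... | yes yz = yz
  ... | no ¬yz = ⊥-elim (claw-free (c , x , y , z , x≢y , x≢z , y≢z , cx , cy , cz , ¬xy , ¬xz , ¬yz))

  -- For u ∈ V_c, the neighbours of u lying in 1-packs other than V_c form a
  -- clique: a missing edge xy gives the claw with centre u and leaves c, x, y.
  cross-neighbours-adjacent :
    ∀ {c d e u x y} → InPack G I c u → InPack G I d x → InPack G I e y →
    d ≢ c → e ≢ c → E G u x → E G u y → x ≢ y → E G x y
  cross-neighbours-adjacent pcu pdx pey d≢c e≢c ux uy x≢y =
    claw-closure (owner-adjacent pcu) ux uy
      (≢-sym (not-in-I pdx c∈I)) (≢-sym (not-in-I pey c∈I)) x≢y
      (λ cx → other-owner-nonadjacent pdx c∈I (≢-sym d≢c) (E-sym G cx))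
      (λ cy → other-owner-nonadjacent pey c∈I (≢-sym e≢c) (E-sym G cy))
    where c∈I = proj₁ pcu

  module FromVertex (v a : Fin n) (pav : InPack G I a v) where

    data Near (u : Fin n) : Set where
      start      : u ≡ v → Near u
      other-pack : ∀ c → c ≢ a → InPack G I c u → E G v u → Near u
      same-pack  : InPack G I a u →
                   ∀ e p → e ≢ a → InPack G I e p → E G v p → E G p u → Near u

    -- If p and u′ lie
    -- in different packs, p ~ u′ (clique at u) and then v ~ u′ (clique at p);
    -- if they share V_d, route through a neighbour t of u′ in a third pack.
    leave-own-pack :
      ∀ {u u′ d e p} → InPack G I a u → InPack G I e p → e ≢ a →
      E G v p → E G p u → E G u u′ → InPack G I d u′ → d ≢ a → InT2 G I u′ →
      E G v u′
    leave-own-pack {u} {u′} {d} {e} {p} pau pep e≢a vp pu uu′ pdu′ d≢a T2u′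
      with u′ ≟ p | e ≟ d
    ... | yes refl | _ = vp
    ... | no u′≢p | no e≢d =
      cross-neighbours-adjacent pep pav pdu′ (≢-sym e≢a) (≢-sym e≢d) (E-sym G vp) pu′
        (distinct-packs pav pdu′ (≢-sym d≢a))
      where
      pu′ : E G p u′
      pu′ = cross-neighbours-adjacent pau pep pdu′ e≢a d≢a (E-sym G pu) uu′ (≢-sym u′≢p)
    ... | no u′≢p | yes refl with T2-escape a T2u′ pdu′
    ...   | g , t , g≢a , g≢d , pgt , u′t =
      E-sym G (cross-neighbours-adjacent pgt pdu′ pav (≢-sym g≢d) (≢-sym g≢a)
                 (E-sym G u′t) (E-sym G vt) (distinct-packs pdu′ pav d≢a))
      where
      ut : E G u t
      ut = cross-neighbours-adjacent pdu′ pau pgt (≢-sym d≢a) g≢d (E-sym G uu′) u′t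
             (distinct-packs pau pgt (≢-sym g≢a))
      pt : E G p t
      pt = cross-neighbours-adjacent pau pep pgt d≢a g≢a (E-sym G pu) ut
             (distinct-packs pep pgt (≢-sym g≢d))
      vt : E G v t
      vt = cross-neighbours-adjacent pep pav pgt (≢-sym d≢a) g≢d (E-sym G vp) pt
             (distinct-packs pav pgt (≢-sym g≢a))

    step : ∀ {u u′} → Near u → EdgeT2 G I u u′ → Near u′
    step (start refl) (_ , _ , vu′ , c , d , c≢d , pcv , pdu′) with owner-unique pcv pav
    ... | refl = other-pack d (≢-sym c≢d) pdu′ vu′
    step {u} {u′} (other-pack c c≢a pcu vu) (_ , _ , uu′ , c′ , d , c′≢d , pc′u , pdu′)
      with owner-unique pc′u pcu | u′ ≟ v
    ... | refl | yes refl = start refl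
    ... | refl | no u′≢v =
      record-pack (cross-neighbours-adjacent pcu pav pdu′ (≢-sym c≢a) (≢-sym c′≢d)
                     (E-sym G vu) uu′ (≢-sym u′≢v))
      where
      -- u′ ~ v by the clique at u; it remains to record which pack u′ is in.
      record-pack : E G v u′ → Near u′
      record-pack vu′ with d ≟ a
      ... | yes refl = same-pack pdu′ c u c≢a pcu vu uu′
      ... | no d≢a  = other-pack d d≢a pdu′ vu′
    step (same-pack pau e p e≢a pep vp pu) (_ , T2u′ , uu′ , c , d , c≢d , pcu , pdu′)
      with owner-unique pcu pau
    ... | refl = other-pack d (≢-sym c≢d) pdu′
                   (leave-own-pack pau pep e≢a vp pu uu′ pdu′ (≢-sym c≢d) T2u′)

    walk : ∀ {u w} → Near u → Star (EdgeT2 G I) u w → Near w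
    walk near ε           = near
    walk near (uu′ ◅ u′w) = walk (step near uu′) u′w

    adjacent-if-near : ∀ {b w} → InPack G I b w → a ≢ b → Near w → E G v w
    adjacent-if-near pbw a≢b (start refl)          = contradiction (owner-unique pav pbw) a≢b
    adjacent-if-near pbw a≢b (other-pack _ _ _ vw) = vw
    adjacent-if-near pbw a≢b (same-pack paw _ _ _ _ _ _) =
      contradiction (owner-unique paw pbw) a≢b

lemma20 : (n : ℕ) (G : Graph n) → ClawFree G →
          (I : Subset n) → MaximumIndependent G I →
          (v w a b : Fin n) → InT2 G I v → InT2 G I w →
          InPack G I a v → InPack G I b w → a ≢ b →
          (E G v w ⇔ SameComponentT2 G I v w)
lemma20 n G claw-free I _ v w a b T2v T2w pav pbw a≢b = mk⇔ edge-is-walk walk-gives-edge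
  where
  open ClawFreePacks G claw-free I
  open FromVertex v a pav

  edge-is-walk : E G v w → SameComponentT2 G I v w
  edge-is-walk vw = T2v , T2w , ((T2v , T2w , vw , a , b , a≢b , pav , pbw) ◅ ε)

  walk-gives-edge : SameComponentT2 G I v w → E G v w
  walk-gives-edge (_ , _ , v⇝w) = adjacent-if-near pbw a≢b (walk (start refl) v⇝w)
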